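{- Let $L$ be the graph with vertex set $\{0,1\}^2=\{00,01,10,11\}$ whose edge set is $\{\{00,01\},\{00,10\},\{00,11\}\}$ (all three edges incident to $00$). Then $$C_M(L)=\log_2\gamma\approx 0.81,$$ where $\gamma^{ -1}$ is the unique positive root of the equation $x+\frac{x^3}{1-x}=1$.
   Context: Let $G$ be a simple graph with vertex set $\{0,1\}^2$, the set of ordered pairs of binary symbols (written as strings $ab$), whose edges are unordered pairs of distinct vertices. Two sequences $\mathbf{x}=(x_1,\dots,x_n),\mathbf{y}=(y_1,\dots,y_n)\in\{0,1\}^n$ are called distinguishable for $G$ if there exists $i\in\{1,\dots,n-1\}$ such that $\{x_ix_{i+1},\,y_iy_{i+1}\}$ is an edge of $G$. Let $M(G,n)$ be the largest cardinality of a set $C\subseteq\{0,1\}^n$ any two distinct elements of which are distinguishable for $G$. The Shannon–Markov capacity of $G$ is $C_M(G)=\limsup_{n\to\infty}\frac1n\log_2 M(G,n)$. -}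

module Defs where

open import Data.Bool using (Bool; true; false)
open import Data.Nat using (ℕ; zero; suc; _+_; _*_; _^_; _<_; _≥_)
open import Data.Product using (_×_; _,_; Σ; ∃; ∃-syntax)
open import Data.Sum using (_⊎_)
open import Data.Vec using (Vec; []; _∷_)
open import Data.List using (List; length)
open import Data.List.Relation.Unary.AllPairs using (AllPairs)
open import Data.List.Relation.Unary.Unique.Propositional using (Unique)
open import Relation.Binary.PropositionalEquality using (_≡_; _≢_)
open import Relation.Nullary using (¬_)
open import Level using (0ℓ) renaming (suc to lsuc)

Vertex : Set
Vertex = Bool × Bool

record SimpleGraph : Set₁ where
  field
    Edge    : Vertex → Vertex → Set
    sym     : ∀ {u v} → Edge u v → Edge v u
    irrefl  : ∀ {u} → ¬ Edge u u

open SimpleGraph public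

data Distinguishable (G : SimpleGraph) : ∀ {n} → Vec Bool n → Vec Bool n → Set where
  here  : ∀ {n a b c d} {xs ys : Vec Bool n} →
          Edge G (a , b) (c , d) →
          Distinguishable G (a ∷ b ∷ xs) (c ∷ d ∷ ys)
  there : ∀ {n a b c d} {xs ys : Vec Bool n} →
          Distinguishable G (b ∷ xs) (d ∷ ys) →
          Distinguishable G (a ∷ b ∷ xs) (c ∷ d ∷ ys)

record Code (G : SimpleGraph) (n : ℕ) : Set where
  field
    words    : List (Vec Bool n)
    distinct : Unique words
    pairwise : AllPairs (Distinguishable G) words

open Code public

∣_∣ᶜ : ∀ {G n} → Code G n → ℕ
∣ C ∣ᶜ = length (words C)

v00 : Vertex
v00 = (false , false)

LEdge : Vertex → Vertex → Set
LEdge u v = (u ≡ v00 × v ≢ v00) ⊎ (v ≡ v00 × u ≢ v00)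

private
  LEdge-sym : ∀ {u v} → LEdge u v → LEdge v u
  LEdge-sym (Data.Sum.inj₁ p) = Data.Sum.inj₂ p
  LEdge-sym (Data.Sum.inj₂ p) = Data.Sum.inj₁ p

  LEdge-irr : ∀ {u} → ¬ LEdge u u
  LEdge-irr (Data.Sum.inj₁ (p , q)) = q p
  LEdge-irr (Data.Sum.inj₂ (p , q)) = q p

L : SimpleGraph
L = record { Edge = LEdge ; sym = LEdge-sym ; irrefl = LEdge-irr }

-- γ > 0 is the reciprocal of the unique positive root of x + x³/(1-x) = 1,
-- i.e. the unique real root of  γ³ - 2γ² + γ - 1 = 0  (≈ 1.7549).
-- For a rational q = a/b (b > 0):  q > γ  ⇔  a³ + a b² > 2a²b + b³,
--                                  q < γ  ⇔  a³ + a b² < 2a²b + b³.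
AboveGamma : ℕ → ℕ → Set
AboveGamma a b = 2 * a ^ 2 * b + b ^ 3 < a ^ 3 + a * b ^ 2

BelowGamma : ℕ → ℕ → Set
BelowGamma a b = a ^ 3 + a * b ^ 2 < 2 * a ^ 2 * b + b ^ 3

-- "C_M(G) = log₂ γ", i.e. limsup_n (1/n) log₂ M(G,n) = log₂ γ, equivalently
-- limsup_n M(G,n)^{1/n} = γ, expressed via rational cuts q = a/b:
--  (i)  every rational q > γ: for all large n, every code C has |C| < qⁿ;
--  (ii) every rational 0 ≤ q < γ: for infinitely many n some code C has |C| > qⁿ.
CapacityIsLog₂Gamma : SimpleGraph → Set
CapacityIsLog₂Gamma G =
  (∀ a b → 0 < b → AboveGamma a b →
     ∃[ N ] ∀ n → n ≥ N → (C : Code G n) → ∣ C ∣ᶜ * b ^ n < a ^ n)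
  × (∀ a b → 0 < b → BelowGamma a b →
     ∀ N → ∃[ n ] (n ≥ N × Σ (Code G n) λ C → a ^ n < ∣ C ∣ᶜ * b ^ n))

{-# OPTIONS --safe #-}
-- The profile of a binary word x₁…xₙ is the word of length n − 1 whose i-th letter is 1 iff
-- xᵢxᵢ₊₁ = 00. As every edge of L joins 00 to another vertex, two words are distinguishable
-- for L iff their profiles differ, and the profiles are exactly the words avoiding the factor
-- 101 (after 00 the next pair starts with 0; after 00 and then 01 it starts with 1). So
-- M(L, n) is the number M n of such words of length n − 1, which obeys
-- M (n + 2) = M (n + 1) + Z n and Z (n + 1) = M n + Z n, a recurrence with characteristic
-- polynomial x³ − 2x² + x − 1, whose largest root is γ. For q = a/b above γ, induction gives
-- M n ≤ qⁿ and Z n ≤ (q − 1) qⁿ⁺¹, strictly from n = 3 on. For q below γ the potential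
-- Φ n = a k M (n + 1) + a b Z n + b² M n, with k = a − b, grows by a factor exceeding q by a
-- fixed amount, and Bernoulli's inequality lets this surplus beat any constant.
module Submission where

open import Defs hiding (sym)
open import Data.Bool using (Bool; true; false; not; _∨_)
open import Data.Bool.Properties using () renaming (_≟_ to _≟ᵇ_)
open import Data.Empty using (⊥; ⊥-elim)
open import Data.Fin using (Fin; zero; suc)
open import Data.Fin.Properties using (injective⇒≤)
open import Data.List using (List; []; _∷_; _++_; map; length; lookup)
open import Data.List.Properties using (length-map; length-++; map-∘; map-id-local)
open import Data.List.Membership.Propositional using (_∈_)
open import Data.List.Membership.Propositional.Properties using (∈-lookup; ∈-map⁺; ∈-map⁻; ∈-++⁺ˡ; ∈-++⁺ʳ)
open import Data.List.Relation.Binary.Disjoint.Propositional using (Disjoint)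
open import Data.List.Relation.Binary.Subset.Propositional using (_⊆_)
open import Data.List.Relation.Unary.All as All using (All; []; _∷_)
import Data.List.Relation.Unary.All.Properties as All
open import Data.List.Relation.Unary.AllPairs as AllPairs using ([]; _∷_)
import Data.List.Relation.Unary.AllPairs.Properties as AllPairs
open import Data.List.Relation.Unary.Any using (here; index)
open import Data.List.Relation.Unary.Any.Properties using (lookup-index)
open import Data.List.Relation.Unary.Unique.Propositional using (Unique)
import Data.List.Relation.Unary.Unique.Propositional.Properties as Unique
open import Data.Nat
open import Data.Nat.Properties
open import Algebra.Properties.CommutativeSemigroup *-commutativeSemigroup using (x∙yz≈y∙xz; x∙yz≈xz∙y)
open import Data.Nat.Solver using (module +-*-Solver)
open import Data.Nat.Tactic.RingSolver using (solve-∀)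
open import Data.Product using (Σ; _×_; _,_; ∃-syntax)
open import Data.Sum using (inj₁; inj₂)
open import Data.Unit using (⊤; tt)
open import Data.Vec as Vec using (Vec; []; _∷_)
open import Data.Vec.Properties using (∷-injectiveʳ)
open import Function using (_∘_)
open import Relation.Binary.PropositionalEquality
open import Relation.Nullary using (¬_; yes; no)

open +-*-Solver using (solve; _:+_; _:*_; _:^_; _:=_; con)

module _ {a} {A : Set a} where

  lookup-injective : ∀ {xs : List A} → Unique xs → ∀ {i j} → lookup xs i ≡ lookup xs j → i ≡ j
  lookup-injective {_ ∷ _} _         {zero}  {zero}  _  = refl
  lookup-injective {_ ∷ _} (x∉ ∷ _)  {zero}  {suc j} eq = ⊥-elim (All.lookup x∉ (∈-lookup j) eq)
  lookup-injective {_ ∷ _} (x∉ ∷ _)  {suc i} {zero}  eq = ⊥-elim (All.lookup x∉ (∈-lookup i) (sym eq))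
  lookup-injective {_ ∷ _} (_ ∷ xs!) {suc i} {suc j} eq = cong suc (lookup-injective xs! eq)

  unique-⊆⇒length≤ : ∀ {xs ys : List A} → Unique xs → xs ⊆ ys → length xs ≤ length ys
  unique-⊆⇒length≤ {xs} {ys} xs! xs⊆ys = injective⇒≤ position-injective
    where
      position : Fin (length xs) → Fin (length ys)
      position i = index (xs⊆ys (∈-lookup i))

      position-injective : ∀ {i j} → position i ≡ position j → i ≡ j
      position-injective {i} {j} eq = lookup-injective xs! (begin
        lookup xs i            ≡⟨ lookup-index (xs⊆ys (∈-lookup i)) ⟩
        lookup ys (position i) ≡⟨ cong (lookup ys) eq ⟩
        lookup ys (position j) ≡⟨ lookup-index (xs⊆ys (∈-lookup j)) ⟨
        lookup xs j            ∎)
        where open ≡-Reasoning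

^-distribʳ-* : ∀ m n o → (m * n) ^ o ≡ m ^ o * n ^ o
^-distribʳ-* m n zero    = refl
^-distribʳ-* m n (suc o) = trans (cong (m * n *_) (^-distribʳ-* m n o)) ([m*n]*[o*p]≡[m*o]*[n*p] m n _ _)

geometric-growth : ∀ {r s} (f : ℕ → ℕ) → (∀ n → r * f n ≤ s * f (suc n)) →
                   ∀ n → r ^ n * f 0 ≤ s ^ n * f n
geometric-growth         f _    zero    = ≤-refl
geometric-growth {r} {s} f step (suc n) = begin
  r * r ^ n * f 0         ≡⟨ *-assoc r _ _ ⟩
  r * (r ^ n * f 0)       ≤⟨ *-monoʳ-≤ r (geometric-growth f step n) ⟩
  r * (s ^ n * f n)       ≡⟨ x∙yz≈y∙xz r (s ^ n) (f n) ⟩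
  s ^ n * (r * f n)       ≤⟨ *-monoʳ-≤ (s ^ n) (step n) ⟩
  s ^ n * (s * f (suc n)) ≡⟨ x∙yz≈y∙xz (s ^ n) s (f (suc n)) ⟩
  s * (s ^ n * f (suc n)) ≡⟨ *-assoc s _ _ ⟨
  s * s ^ n * f (suc n)   ∎
  where open ≤-Reasoning

-- Bernoulli's inequality (1 + 1/x)ⁿ ≥ 1 + n/x, multiplied by xⁿ⁺¹.
bernoulli : ∀ x n → x ^ n * (x + n) ≤ x * (x + 1) ^ n
bernoulli x zero    = ≤-reflexive (unit x)
  where
    unit : ∀ x → 1 * (x + 0) ≡ x * 1
    unit = solve-∀
bernoulli x (suc n) = begin
  x * x ^ n * (x + suc n)       ≡⟨ reassoc x (x ^ n) n ⟩
  x ^ n * (x * (x + suc n))     ≤⟨ *-monoʳ-≤ (x ^ n) (m≤m+n _ n) ⟩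
  x ^ n * (x * (x + suc n) + n) ≡⟨ cong (x ^ n *_) (expand x n) ⟩
  x ^ n * ((x + 1) * (x + n))   ≡⟨ x∙yz≈y∙xz (x ^ n) (x + 1) (x + n) ⟩
  (x + 1) * (x ^ n * (x + n))   ≤⟨ *-monoʳ-≤ (x + 1) (bernoulli x n) ⟩
  (x + 1) * (x * (x + 1) ^ n)   ≡⟨ x∙yz≈y∙xz (x + 1) x ((x + 1) ^ n) ⟩
  x * ((x + 1) * (x + 1) ^ n)   ∎
  where
    open ≤-Reasoning
    reassoc : ∀ x y n → x * y * (x + suc n) ≡ y * (x * (x + suc n))
    reassoc = solve-∀
    expand : ∀ x n → x * (x + suc n) + n ≡ (x + 1) * (x + n)
    expand = solve-∀

-- Profiles

is00 : Vertex → Bool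
is00 (false , false) = true
is00 (false , true)  = false
is00 (true  , _)     = false

is00-true : ∀ {v} → is00 v ≡ true → v ≡ v00
is00-true {false , false} _  = refl
is00-true {false , true}  ()
is00-true {true  , _}     ()

LEdge⇒is00≢ : ∀ {u v} → LEdge u v → is00 u ≢ is00 v
LEdge⇒is00≢ (inj₁ (refl , v≢00)) eq = v≢00 (is00-true (sym eq))
LEdge⇒is00≢ (inj₂ (refl , u≢00)) eq = u≢00 (is00-true eq)

is00≢⇒LEdge : ∀ u v → is00 u ≢ is00 v → LEdge u v
is00≢⇒LEdge (false , false) v               ne = inj₁ (refl , λ v≡00 → ne (cong is00 (sym v≡00)))
is00≢⇒LEdge u               (false , false) ne = inj₂ (refl , λ u≡00 → ne (cong is00 u≡00))
is00≢⇒LEdge (false , true)  (false , true)  ne = ⊥-elim (ne refl)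
is00≢⇒LEdge (false , true)  (true  , _)     ne = ⊥-elim (ne refl)
is00≢⇒LEdge (true  , _)     (false , true)  ne = ⊥-elim (ne refl)
is00≢⇒LEdge (true  , _)     (true  , _)     ne = ⊥-elim (ne refl)

profile : ∀ {m} → Vec Bool (suc m) → Vec Bool m
profile (_ ∷ [])     = []
profile (x ∷ y ∷ xs) = is00 (x , y) ∷ profile (y ∷ xs)

profile-∷ : ∀ {m} c (x : Vec Bool (suc m)) {q p} →
            is00 (c , Vec.head x) ≡ q → profile x ≡ p → profile (c ∷ x) ≡ q ∷ p
profile-∷ c (_ ∷ _) = cong₂ _∷_

distinguishable⇒profile≢ : ∀ {m} {x y : Vec Bool (suc m)} → Distinguishable L x y → profile x ≢ profile y
distinguishable⇒profile≢ (here e)  eq = LEdge⇒is00≢ e (cong Vec.head eq)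
distinguishable⇒profile≢ (there d) eq = distinguishable⇒profile≢ d (cong Vec.tail eq)

profile≢⇒distinguishable : ∀ {m} (x y : Vec Bool (suc m)) → profile x ≢ profile y → Distinguishable L x y
profile≢⇒distinguishable (_ ∷ [])     (_ ∷ [])     ne = ⊥-elim (ne refl)
profile≢⇒distinguishable (a ∷ b ∷ xs) (c ∷ d ∷ ys) ne with is00 (a , b) ≟ᵇ is00 (c , d)
... | no  heads≢ = here (is00≢⇒LEdge _ _ heads≢)
... | yes heads≡ = there (profile≢⇒distinguishable (b ∷ xs) (d ∷ ys) (ne ∘ cong₂ _∷_ heads≡))

-- Words without the factor 101

-- Admissible free p says that p avoids 101; the phases are the states of the automaton
-- recognising such words: seen1 after a 1, seen10 after 1 0.
data Phase : Set where
  free seen1 seen10 : Phase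

Admissible : ∀ {m} → Phase → Vec Bool m → Set
Admissible _      []          = ⊤
Admissible free   (false ∷ p) = Admissible free p
Admissible free   (true  ∷ p) = Admissible seen1 p
Admissible seen1  (false ∷ p) = Admissible seen10 p
Admissible seen1  (true  ∷ p) = Admissible seen1 p
Admissible seen10 (false ∷ p) = Admissible free p
Admissible seen10 (true  ∷ _) = ⊥

-- The possible first letters of a word whose profile is read from a phase: after the pair
-- 00 it is 0, after 00 and then 01 it is 1.
Compatible : Phase → Bool → Set
Compatible free   _ = ⊤
Compatible seen1  c = c ≡ false
Compatible seen10 c = c ≡ true

profile-admissible : ∀ {m} s c (xs : Vec Bool m) → Compatible s c → Admissible s (profile (c ∷ xs))
profile-admissible _      _     []           _  = tt
profile-admissible free   false (false ∷ xs) _  = profile-admissible seen1 false xs refl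
profile-admissible free   false (true  ∷ xs) _  = profile-admissible free true xs tt
profile-admissible free   true  (d ∷ xs)     _  = profile-admissible free d xs tt
profile-admissible seen1  false (false ∷ xs) _  = profile-admissible seen1 false xs refl
profile-admissible seen1  false (true  ∷ xs) _  = profile-admissible seen10 true xs refl
profile-admissible seen10 true  (d ∷ xs)     _  = profile-admissible free d xs tt
profile-admissible seen1  true  (_ ∷ _)      ()
profile-admissible seen10 false (_ ∷ _)      ()

module _ {m : ℕ} where

  branch : List (Vec Bool m) → List (Vec Bool m) → List (Vec Bool (suc m))
  branch ps qs = map (false ∷_) ps ++ map (true ∷_) qs

  branch-unique : ∀ {ps qs} → Unique ps → Unique qs → Unique (branch ps qs)
  branch-unique ps! qs! =
    Unique.++⁺ (Unique.map⁺ ∷-injectiveʳ ps!) (Unique.map⁺ ∷-injectiveʳ qs!) disjoint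
    where
      disjoint : ∀ {ps qs} → Disjoint (map (false ∷_) ps) (map (true ∷_) qs)
      disjoint (v∈ps , v∈qs) with ∈-map⁻ _ v∈ps | ∈-map⁻ _ v∈qs
      ... | _ , _ , refl | _ , _ , ()

  ∈-branchˡ : ∀ {p ps} qs → p ∈ ps → false ∷ p ∈ branch ps qs
  ∈-branchˡ _ p∈ps = ∈-++⁺ˡ (∈-map⁺ _ p∈ps)

  ∈-branchʳ : ∀ {q qs} ps → q ∈ qs → true ∷ q ∈ branch ps qs
  ∈-branchʳ ps q∈qs = ∈-++⁺ʳ (map _ ps) (∈-map⁺ _ q∈qs)

  All-branch : ∀ {P : Vec Bool (suc m) → Set} {ps qs} →
               All (P ∘ (false ∷_)) ps → All (P ∘ (true ∷_)) qs → All P (branch ps qs)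
  All-branch Pps Pqs = All.++⁺ (All.map⁺ Pps) (All.map⁺ Pqs)

  length-branch : ∀ ps qs → length (branch ps qs) ≡ length ps + length qs
  length-branch ps qs = trans (length-++ (map _ ps)) (cong₂ _+_ (length-map _ ps) (length-map _ qs))

admissible : Phase → (m : ℕ) → List (Vec Bool m)
admissible _      zero    = [] ∷ []
admissible free   (suc m) = branch (admissible free m) (admissible seen1 m)
admissible seen1  (suc m) = branch (admissible seen10 m) (admissible seen1 m)
admissible seen10 (suc m) = branch (admissible free m) []

admissible-unique : ∀ s m → Unique (admissible s m)
admissible-unique _      zero    = [] ∷ []
admissible-unique free   (suc m) = branch-unique (admissible-unique free m) (admissible-unique seen1 m)
admissible-unique seen1  (suc m) = branch-unique (admissible-unique seen10 m) (admissible-unique seen1 m)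
admissible-unique seen10 (suc m) = branch-unique (admissible-unique free m) []

admissible-sound : ∀ s m → All (Admissible s) (admissible s m)
admissible-sound _      zero    = tt ∷ []
admissible-sound free   (suc m) = All-branch (admissible-sound free m) (admissible-sound seen1 m)
admissible-sound seen1  (suc m) = All-branch (admissible-sound seen10 m) (admissible-sound seen1 m)
admissible-sound seen10 (suc m) = All-branch (admissible-sound free m) []

admissible-complete : ∀ s {m} (p : Vec Bool m) → Admissible s p → p ∈ admissible s m
admissible-complete _      []          _  = here refl
admissible-complete free   (false ∷ p) ok = ∈-branchˡ _ (admissible-complete free p ok)
admissible-complete free   (true  ∷ p) ok = ∈-branchʳ _ (admissible-complete seen1 p ok)
admissible-complete seen1  (false ∷ p) ok = ∈-branchˡ _ (admissible-complete seen10 p ok)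
admissible-complete seen1  (true  ∷ p) ok = ∈-branchʳ _ (admissible-complete seen1 p ok)
admissible-complete seen10 (false ∷ p) ok = ∈-branchˡ _ (admissible-complete free p ok)

-- M n turns out to be M(L, n); Z n counts the words of length n admissible from seen1.
mutual
  M : ℕ → ℕ
  M zero          = 1
  M (suc zero)    = 1
  M (suc (suc n)) = M (suc n) + Z n

  Z : ℕ → ℕ
  Z zero    = 1
  Z (suc n) = M n + Z n

mutual
  M-mono : ∀ n → M n ≤ M (suc n)
  M-mono zero    = ≤-refl
  M-mono (suc n) = m≤m+n (M (suc n)) (Z n)

  Z≤M : ∀ n → Z n ≤ M (suc n)
  Z≤M zero    = ≤-refl
  Z≤M (suc n) = +-monoˡ-≤ (Z n) (M-mono n)

count : Phase → ℕ → ℕ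
count free   m = M (suc m)
count seen1  m = Z m
count seen10 m = M m

length-admissible : ∀ s m → length (admissible s m) ≡ count s m
length-admissible free   zero    = refl
length-admissible seen1  zero    = refl
length-admissible seen10 zero    = refl
length-admissible free   (suc m) = trans (length-branch (admissible free m) _)
  (cong₂ _+_ (length-admissible free m) (length-admissible seen1 m))
length-admissible seen1  (suc m) = trans (length-branch (admissible seen10 m) _)
  (cong₂ _+_ (length-admissible seen10 m) (length-admissible seen1 m))
length-admissible seen10 (suc m) = trans (length-branch (admissible free m) [])
  (trans (+-identityʳ _) (length-admissible free m))

lastRead : Phase → Bool
lastRead free   = false
lastRead seen1  = true
lastRead seen10 = false

-- Letter i of realize r p is 0 exactly when a profile letter next to it is 1, r standing
-- for the letter before p.
realize : ∀ {m} → Bool → Vec Bool m → Vec Bool (suc m)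
realize r []      = not r ∷ []
realize r (q ∷ p) = not (r ∨ q) ∷ realize q p

head-realize-true : ∀ {m} (p : Vec Bool m) → Vec.head (realize true p) ≡ false
head-realize-true []      = refl
head-realize-true (_ ∷ _) = refl

head-realize-seen10 : ∀ {m} (p : Vec Bool m) → Admissible seen10 p → Vec.head (realize false p) ≡ true
head-realize-seen10 []          _ = refl
head-realize-seen10 (false ∷ _) _ = refl

profile-realize : ∀ s {m} (p : Vec Bool m) → Admissible s p → profile (realize (lastRead s) p) ≡ p
profile-realize _      []          _  = refl
profile-realize free   (false ∷ p) ok = profile-∷ true _ refl (profile-realize free p ok)
profile-realize free   (true  ∷ p) ok =
  profile-∷ false _ (cong (is00 ∘ (false ,_)) (head-realize-true p)) (profile-realize seen1 p ok)
profile-realize seen1  (false ∷ p) ok =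
  profile-∷ false _ (cong (is00 ∘ (false ,_)) (head-realize-seen10 p ok)) (profile-realize seen10 p ok)
profile-realize seen1  (true  ∷ p) ok =
  profile-∷ false _ (cong (is00 ∘ (false ,_)) (head-realize-true p)) (profile-realize seen1 p ok)
profile-realize seen10 (false ∷ p) ok = profile-∷ true _ refl (profile-realize free p ok)

code-size≤ : ∀ {m} (C : Code L (suc m)) → ∣ C ∣ᶜ ≤ M (suc m)
code-size≤ {m} C = begin
  length (words C)               ≡⟨ length-map profile (words C) ⟨
  length (map profile (words C)) ≤⟨ unique-⊆⇒length≤ profiles! profiles⊆admissible ⟩
  length (admissible free m)     ≡⟨ length-admissible free m ⟩
  M (suc m)                      ∎
  where
    open ≤-Reasoning

    profiles! : Unique (map profile (words C))
    profiles! = AllPairs.map⁺ (AllPairs.map distinguishable⇒profile≢ (pairwise C))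

    profiles⊆admissible : map profile (words C) ⊆ admissible free m
    profiles⊆admissible p∈ with ∈-map⁻ profile p∈
    ... | c ∷ xs , _ , refl = admissible-complete free _ (profile-admissible free c xs tt)

realizations : ∀ m → List (Vec Bool (suc m))
realizations m = map (realize false) (admissible free m)

profile-realizations : ∀ m → map profile (realizations m) ≡ admissible free m
profile-realizations m = trans (sym (map-∘ (admissible free m)))
  (map-id-local (All.map (λ {p} → profile-realize free p) (admissible-sound free m)))

optimalCode : ∀ n → Code L n
optimalCode zero    = record { words = [] ∷ [] ; distinct = [] ∷ [] ; pairwise = [] ∷ [] }
optimalCode (suc m) = record
  { words    = realizations m
  ; distinct = Unique.map⁻ profiles!
  ; pairwise = AllPairs.map (λ {x} {y} → profile≢⇒distinguishable x y) (AllPairs.map⁻ profiles!)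
  }
  where
    profiles! : Unique (map profile (realizations m))
    profiles! = subst Unique (sym (profile-realizations m)) (admissible-unique free m)

optimalCode-size : ∀ n → ∣ optimalCode n ∣ᶜ ≡ M n
optimalCode-size zero    = refl
optimalCode-size (suc m) = trans (length-map _ (admissible free m)) (length-admissible free m)

-- Growth of M

-- a³ + ab² − 2a²b = a(a − b)², so a/b lies above γ iff b³ < a(a − b)².
gamma-identity : ∀ b k → (b + k) ^ 3 + (b + k) * b ^ 2 ≡ 2 * (b + k) ^ 2 * b + (b + k) * k * k
gamma-identity = solve 2 (λ b k → (b :+ k) :^ 3 :+ (b :+ k) :* b :^ 2
                              := con 2 :* (b :+ k) :^ 2 :* b :+ (b :+ k) :* k :* k) refl

mirrored-gamma-identity : ∀ a j → a ^ 3 + a * (a + j) ^ 2 ≡ 2 * a ^ 2 * (a + j) + a * j * j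
mirrored-gamma-identity = solve 2 (λ a j → a :^ 3 :+ a :* (a :+ j) :^ 2
                                       := con 2 :* a :^ 2 :* (a :+ j) :+ a :* j :* j) refl

cube : ∀ b → b ^ 3 ≡ b * b * b
cube = solve 1 (λ b → b :^ 3 := b :* b :* b) refl

AboveGamma⇒gap : ∀ b k → AboveGamma (b + k) b → b * b * b < (b + k) * k * k
AboveGamma⇒gap b k above = +-cancelˡ-< (2 * (b + k) ^ 2 * b) _ _
  (subst₂ _<_ (cong (2 * (b + k) ^ 2 * b +_) (cube b)) (gamma-identity b k) above)

BelowGamma⇒gap : ∀ b k → BelowGamma (b + k) b → (b + k) * k * k < b * b * b
BelowGamma⇒gap b k below = +-cancelˡ-< (2 * (b + k) ^ 2 * b) _ _
  (subst₂ _<_ (gamma-identity b k) (cong (2 * (b + k) ^ 2 * b +_) (cube b)) below)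

≤⇒¬AboveGamma : ∀ {a b} → a ≤ b → ¬ AboveGamma a b
≤⇒¬AboveGamma {a} a≤b with m≤n⇒∃[o]m+o≡n a≤b
... | j , refl = λ above → <⇒≱
  (+-cancelˡ-< (2 * a ^ 2 * (a + j)) _ _
    (subst₂ _<_ (cong (2 * a ^ 2 * (a + j) +_) (cube (a + j))) (mirrored-gamma-identity a j) above))
  (*-mono-≤ (*-mono-≤ (m≤m+n a j) (m≤n+m j a)) (m≤n+m j a))

AboveGamma⇒> : ∀ {a b} → AboveGamma a b → a > b
AboveGamma⇒> above = ≰⇒> λ a≤b → ≤⇒¬AboveGamma a≤b above

module UpperBound (b k : ℕ) (gap : b * b * b < (b + k) * k * k) where

  a : ℕ
  a = b + k

  instance
    a≢0 : NonZero a
    a≢0 = m*n≢0⇒m≢0 a {{m*n≢0⇒m≢0 (a * k) {{>-nonZero (≤-<-trans z≤n gap)}}}}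

  b*b≤a*k : b * b ≤ a * k
  b*b≤a*k with b ≤? k
  ... | yes b≤k = *-mono-≤ (m≤m+n b k) b≤k
  ... | no  b≰k = <⇒≤ (*-cancelʳ-< b (b * b) (a * k)
                    (<-≤-trans gap (*-monoʳ-≤ (a * k) (≰⇒≥ b≰k))))

  split : ∀ X Y B → (X + Y) * (b * B) ≡ b * (X * B) + Y * (b * B)
  split X Y B = trans (*-distribʳ-+ (b * B) X Y) (cong (_+ Y * (b * B)) (x∙yz≈y∙xz X b B))

  mutual
    M-bound : ∀ n → M n * b ^ n ≤ a ^ n
    M-bound zero          = ≤-refl
    M-bound (suc zero)    = subst (_≤ a * 1) (sym (*-identityˡ (b * 1))) (*-monoˡ-≤ 1 (m≤m+n b k))
    M-bound (suc (suc n)) = begin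
      (M (suc n) + Z n) * b ^ (2 + n)                   ≡⟨ split (M (suc n)) (Z n) (b ^ suc n) ⟩
      b * (M (suc n) * b ^ suc n) + Z n * b ^ (2 + n)   ≤⟨ +-mono-≤ (*-monoʳ-≤ b (M-bound (suc n)))
                                                                     (Z-bound n) ⟩
      b * a ^ suc n + k * a ^ suc n                     ≡⟨ *-distribʳ-+ (a ^ suc n) b k ⟨
      a ^ (2 + n)                                       ∎
      where open ≤-Reasoning

    Z-bound : ∀ n → Z n * b ^ (2 + n) ≤ k * a ^ (1 + n)
    Z-bound zero    = begin
      1 * (b * (b * 1)) ≡⟨ trans (*-identityˡ _) (cong (b *_) (*-identityʳ b)) ⟩
      b * b             ≤⟨ b*b≤a*k ⟩
      a * k             ≡⟨ trans (*-comm a k) (cong (k *_) (sym (*-identityʳ a))) ⟩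
      k * (a * 1)       ∎
      where open ≤-Reasoning
    Z-bound (suc n) = <⇒≤ (Z-bound-strict n)

    Z-bound-strict : ∀ n → Z (suc n) * b ^ (3 + n) < k * a ^ (2 + n)
    Z-bound-strict n = begin-strict
      (M n + Z n) * b ^ (3 + n)                           ≡⟨ split3 (M n) (Z n) b (b ^ n) ⟩
      b * b * b * (M n * b ^ n) + b * (Z n * b ^ (2 + n)) ≤⟨ +-mono-≤ (*-monoʳ-≤ (b * b * b) (M-bound n))
                                                                       (*-monoʳ-≤ b (Z-bound n)) ⟩
      b * b * b * a ^ n + b * (k * a ^ (1 + n))           <⟨ +-monoˡ-< _ (*-monoˡ-< (a ^ n) {{m^n≢0 a n}} gap) ⟩
      a * k * k * a ^ n + b * (k * a ^ (1 + n))           ≡⟨ regroup b k (a ^ n) ⟩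
      k * a ^ (2 + n)                                     ∎
      where
        open ≤-Reasoning
        split3 : ∀ X Y b B → (X + Y) * (b * (b * (b * B))) ≡ b * b * b * (X * B) + b * (Y * (b * (b * B)))
        split3 = solve-∀
        regroup : ∀ b k A → (b + k) * k * k * A + b * (k * ((b + k) * A)) ≡ k * ((b + k) * ((b + k) * A))
        regroup = solve-∀

  M-bound-strict : ∀ n → M (3 + n) * b ^ (3 + n) < a ^ (3 + n)
  M-bound-strict n = begin-strict
    (M (2 + n) + Z (1 + n)) * b ^ (3 + n)                   ≡⟨ split (M (2 + n)) (Z (1 + n)) (b ^ (2 + n)) ⟩
    b * (M (2 + n) * b ^ (2 + n)) + Z (1 + n) * b ^ (3 + n) <⟨ +-mono-≤-< (*-monoʳ-≤ b (M-bound (2 + n)))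
                                                                          (Z-bound-strict n) ⟩
    b * a ^ (2 + n) + k * a ^ (2 + n)                       ≡⟨ *-distribʳ-+ (a ^ (2 + n)) b k ⟨
    a ^ (3 + n)                                             ∎
    where open ≤-Reasoning

module LowerBound (b k : ℕ) (b>0 : 0 < b) (gap : (b + k) * k * k < b * b * b) where

  a : ℕ
  a = b + k

  Φ : ℕ → ℕ
  Φ n = a * k * M (suc n) + a * b * Z n + b * b * M n

  K : ℕ
  K = Φ 0

  instance
    b≢0 : NonZero b
    b≢0 = >-nonZero b>0

    a≢0 : NonZero a
    a≢0 = >-nonZero (≤-trans b>0 (m≤m+n b k))

    K≢0 : NonZero K
    K≢0 = >-nonZero (<-≤-trans (>-nonZero⁻¹ (b * b * 1) {{m*n≢0 (b * b) 1 {{m*n≢0 b b}}}}) (m≤n+m _ _))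

  -- b Φ(n+1) − a Φ(n) = (b³ − a k²) M(n+1).
  Φ-step : ∀ n → a * Φ n + M (suc n) ≤ b * Φ (suc n)
  Φ-step n = begin
    a * Φ n + M (suc n)                             ≡⟨ expand b k (M (suc n)) (Z n) (M n) ⟩
    (1 + a * k * k) * M (suc n) + R                 ≤⟨ +-monoˡ-≤ R (*-monoˡ-≤ (M (suc n)) gap) ⟩
    b * b * b * M (suc n) + R                       ≡⟨ collect b k (M (suc n)) (Z n) (M n) ⟩
    b * Φ (suc n)                                   ∎
    where
      open ≤-Reasoning
      R : ℕ
      R = a * b * k * M (suc n) + a * a * b * Z n + a * b * b * M n
      expand : ∀ b k M₁ Z₀ M₀ →
        (b + k) * ((b + k) * k * M₁ + (b + k) * b * Z₀ + b * b * M₀) + M₁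
          ≡ (1 + (b + k) * k * k) * M₁
            + ((b + k) * b * k * M₁ + (b + k) * (b + k) * b * Z₀ + (b + k) * b * b * M₀)
      expand = solve-∀
      collect : ∀ b k M₁ Z₀ M₀ →
        b * b * b * M₁ + ((b + k) * b * k * M₁ + (b + k) * (b + k) * b * Z₀ + (b + k) * b * b * M₀)
          ≡ b * ((b + k) * k * (M₁ + Z₀) + (b + k) * b * (M₀ + Z₀) + b * b * M₁)
      collect = solve-∀

  Φ≤ : ∀ n → Φ n ≤ K * M (suc n)
  Φ≤ n = begin
    a * k * M (suc n) + a * b * Z n + b * b * M n
      ≤⟨ +-mono-≤ (+-monoʳ-≤ (a * k * M (suc n)) (*-monoʳ-≤ (a * b) (Z≤M n)))
                  (*-monoʳ-≤ (b * b) (M-mono n)) ⟩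
    a * k * M (suc n) + a * b * M (suc n) + b * b * M (suc n) ≡⟨ factor (a * k) (a * b) (b * b) (M (suc n)) ⟩
    K * M (suc n) ∎
    where
      open ≤-Reasoning
      factor : ∀ x y z X → x * X + y * X + z * X ≡ (x * 1 + y * 1 + z * 1) * X
      factor = solve-∀

  Φ-growth : ∀ n → (a * K + 1) * Φ n ≤ K * b * Φ (suc n)
  Φ-growth n = begin
    (a * K + 1) * Φ n              ≡⟨ unfold a K (Φ n) ⟩
    K * (a * Φ n) + Φ n            ≤⟨ +-monoʳ-≤ (K * (a * Φ n)) (Φ≤ n) ⟩
    K * (a * Φ n) + K * M (suc n)  ≡⟨ *-distribˡ-+ K _ _ ⟨
    K * (a * Φ n + M (suc n))      ≤⟨ *-monoʳ-≤ K (Φ-step n) ⟩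
    K * (b * Φ (suc n))            ≡⟨ *-assoc K b _ ⟨
    K * b * Φ (suc n)              ∎
    where
      open ≤-Reasoning
      unfold : ∀ a K F → (a * K + 1) * F ≡ K * (a * F) + F
      unfold = solve-∀

  -- With x = a K, Φ grows by the factor (x + 1)/(K b) = (a/b)(1 + 1/x), and
  -- (1 + 1/x)ⁿ ≥ 1 + n/x > a/b once n > a x.
  M-above-power : ∀ n → a * (a * K) < n → a ^ suc n < M (suc n) * b ^ suc n
  M-above-power n large = *-cancelˡ-< (K ^ n * x) _ _ (begin-strict
    K ^ n * x * (a * a ^ n)               ≡⟨ rearrange (K ^ n) x a (a ^ n) ⟩
    a ^ n * K ^ n * (a * x)               ≡⟨ cong (_* (a * x)) (^-distribʳ-* a K n) ⟨
    x ^ n * (a * x)                       <⟨ *-monoʳ-< (x ^ n) {{m^n≢0 x n}} ax<b[x+n] ⟩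
    x ^ n * (b * (x + n))                 ≡⟨ x∙yz≈y∙xz (x ^ n) b (x + n) ⟩
    b * (x ^ n * (x + n))                 ≤⟨ *-monoʳ-≤ b (bernoulli x n) ⟩
    b * (x * (x + 1) ^ n)                 ≤⟨ *-monoʳ-≤ b (*-monoʳ-≤ x potential) ⟩
    b * (x * ((K * b) ^ n * M (suc n)))   ≡⟨ cong (λ t → b * (x * (t * M (suc n)))) (^-distribʳ-* K b n) ⟩
    b * (x * (K ^ n * b ^ n * M (suc n))) ≡⟨ rearrange′ b x (K ^ n) (b ^ n) (M (suc n)) ⟩
    K ^ n * x * (M (suc n) * (b * b ^ n)) ∎)
    where
      open ≤-Reasoning
      x : ℕ
      x = a * K

      instance
        x≢0 : NonZero x
        x≢0 = m*n≢0 a K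

      potential : (x + 1) ^ n ≤ (K * b) ^ n * M (suc n)
      potential = *-cancelʳ-≤ _ _ K (begin
        (x + 1) ^ n * K               ≤⟨ geometric-growth Φ Φ-growth n ⟩
        (K * b) ^ n * Φ n             ≤⟨ *-monoʳ-≤ ((K * b) ^ n) (Φ≤ n) ⟩
        (K * b) ^ n * (K * M (suc n)) ≡⟨ x∙yz≈xz∙y ((K * b) ^ n) K (M (suc n)) ⟩
        (K * b) ^ n * M (suc n) * K   ∎)

      ax<b[x+n] : a * x < b * (x + n)
      ax<b[x+n] = <-≤-trans large (≤-trans (m≤n+m n x) (m≤n*m (x + n) b))

      rearrange : ∀ P x a Q → P * x * (a * Q) ≡ Q * P * (a * x)
      rearrange = solve-∀
      rearrange′ : ∀ b x P Q F → b * (x * (P * Q * F)) ≡ P * x * (F * (b * Q))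
      rearrange′ = solve-∀

  M-above-power-often : ∀ N → ∃[ n ] (n ≥ N × a ^ n < M n * b ^ n)
  M-above-power-often N = suc n , ≤-trans (m≤m+n N _) (n≤1+n n) , M-above-power n (m≤n+m _ N)
    where
      n : ℕ
      n = N + suc (a * (a * K))

M-below-power : ∀ a b → AboveGamma a b → ∀ n → n ≥ 3 → M n * b ^ n < a ^ n
M-below-power a b above (suc (suc (suc n))) (s≤s (s≤s (s≤s _)))
  with m≤n⇒∃[o]m+o≡n {b} {a} (<⇒≤ (AboveGamma⇒> above))
... | k , refl = UpperBound.M-bound-strict b k (AboveGamma⇒gap b k above) n

M-above-power-often : ∀ a b → 0 < b → BelowGamma a b → ∀ N → ∃[ n ] (n ≥ N × a ^ n < M n * b ^ n)
M-above-power-often a b b>0 below N with ≤-total b a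
... | inj₁ b≤a with m≤n⇒∃[o]m+o≡n b≤a
...   | k , refl = LowerBound.M-above-power-often b k b>0 (BelowGamma⇒gap b k below) N
M-above-power-often a b b>0 below N | inj₂ a≤b =
  let n , n≥N , bⁿ< = LowerBound.M-above-power-often b 0 b>0 gap₀ N
  in  n , n≥N , ≤-<-trans (^-monoˡ-≤ n (≤-trans a≤b (m≤m+n b 0))) bⁿ<
  where
    -- a/b ≤ 1 = b/b, and 1 lies below γ.
    gap₀ : (b + 0) * 0 * 0 < b * b * b
    gap₀ = subst (_< b * b * b) (sym (*-zeroʳ ((b + 0) * 0))) (*-mono-< (*-mono-< b>0 b>0) b>0)

theorem3 : CapacityIsLog₂Gamma L
theorem3 = upper , lower
  where
    upper : ∀ a b → 0 < b → AboveGamma a b →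
            ∃[ N ] ∀ n → n ≥ N → (C : Code L n) → ∣ C ∣ᶜ * b ^ n < a ^ n
    upper a b _ above = 3 , λ where
      zero    ()  _
      (suc m) n≥3 C → ≤-<-trans (*-monoˡ-≤ (b ^ suc m) (code-size≤ C))
                                (M-below-power a b above (suc m) n≥3)

    lower : ∀ a b → 0 < b → BelowGamma a b →
            ∀ N → ∃[ n ] (n ≥ N × Σ (Code L n) λ C → a ^ n < ∣ C ∣ᶜ * b ^ n)
    lower a b b>0 below N =
      let n , n≥N , aⁿ< = M-above-power-often a b b>0 below N
      in  n , n≥N , optimalCode n , subst (λ c → a ^ n < c * b ^ n) (sym (optimalCode-size n)) aⁿ<
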